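{- Let $m$ be even, let $r$ be an integer with $0\le r\le m$, and let $f\colon\mathbb{F}_2^m\to\mathbb{F}_2$ be a bent function. For $\lambda\in\mathbb{F}_2^r$ define $f_\lambda\colon\mathbb{F}_2^{m-r}\to\mathbb{F}_2$ by $f_\lambda(t)=f(t,\lambda)$. Then for every $\lambda\in\mathbb{F}_2^r$ and every $a\in\mathbb{F}_2^{m-r}$, the Walsh coefficient $\widehat{f_\lambda}(a)$ lies in the set $W_r=\{2^{m/2}-i\cdot 2^{m/2-r+1} : 0\le i\le 2^r\}$.
   Context: For a Boolean function $g\colon\mathbb{F}_2^n\to\mathbb{F}_2$, the Walsh coefficient at $a\in\mathbb{F}_2^n$ is $\widehat{g}(a)=\sum_{x\in\mathbb{F}_2^n}(-1)^{g(x)+a\cdot x}$, where $a\cdot x$ is the standard dot product. For $m$ even, $f\colon\mathbb{F}_2^m\to\mathbb{F}_2$ is bent if for every nonzero $a\in\mathbb{F}_2^m$ and $b\in\mathbb{F}_2$ the equation $f(x+a)+f(x)=b$ has exactly $2^{m-1}$ solutions; equivalently, $\widehat f(a)\in\{\pm 2^{m/2}\}$ for all $a$. Here $\mathbb{F}_2^m$ is identified with $\mathbb{F}_2^{m-r}\times\mathbb{F}_2^r$. -}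

module Defs where

open import Data.Bool using (Bool; true; false; _xor_; _∧_)
open import Data.Nat using (ℕ; zero; suc; _∸_; _+_; _*_; _^_)
open import Data.Integer as ℤ using (ℤ; +_; -_)
open import Data.List using (List; []; _∷_; map; _++_; filter; length)
import Data.List as L
open import Data.Vec using (Vec; []; _∷_; zipWith; foldr)
open import Relation.Nullary using (¬_)
open import Relation.Binary.PropositionalEquality using (_≡_)
open import Data.Bool using (_≟_)

-- 𝔽₂ is modelled by Bool (addition = xor, multiplication = ∧); 𝔽₂ⁿ by Vec Bool n.

allVecs : (n : ℕ) → List (Vec Bool n)
allVecs zero = [] ∷ []
allVecs (suc n) = map (false ∷_) (allVecs n) ++ map (true ∷_) (allVecs n)

_⊕_ : ∀ {n} → Vec Bool n → Vec Bool n → Vec Bool n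
_⊕_ = zipWith _xor_

dot : ∀ {n} → Vec Bool n → Vec Bool n → Bool
dot a x = foldr _ _xor_ false (zipWith _∧_ a x)

zeroVec : (n : ℕ) → Vec Bool n
zeroVec zero = []
zeroVec (suc n) = false ∷ zeroVec n

sgn : Bool → ℤ
sgn false = + 1
sgn true = - (+ 1)

walsh : ∀ {n} → (Vec Bool n → Bool) → Vec Bool n → ℤ
walsh {n} g a = L.foldr ℤ._+_ (+ 0) (map (λ x → sgn (g x xor dot a x)) (allVecs n))

derivCount : ∀ {n} → (Vec Bool n → Bool) → Vec Bool n → Bool → ℕ
derivCount {n} f a b = length (filter (λ x → ((f (x ⊕ a)) xor (f x)) ≟ b) (allVecs n))

IsBent : ∀ {m} → (Vec Bool m → Bool) → Set
IsBent {m} f = ∀ (a : Vec Bool m) → ¬ (a ≡ zeroVec m) → ∀ (b : Bool) → derivCount f a b ≡ 2 ^ (m ∸ 1)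

-- A bent function has a balanced derivative in every nonzero direction, so its autocorrelation
-- vanishes away from 0 and every Walsh coefficient satisfies f̂(u)² = 2^m, i.e. f̂(u) = ±2^(m/2).
-- Fourier inversion in the last r coordinates gives 2^r · f̂_λ(a) = Σ_b (-1)^(b·λ) f̂(a, b), a sum of
-- 2^r terms ±2^(m/2); if i of them are negative it equals 2^(m/2+r) − i · 2^(m/2+1).

module Submission where

open import Defs
open import Data.Bool using (Bool; true; false; _xor_; _∧_)
open import Data.Vec using (Vec; []; _∷_; _++_; cast)
open import Data.Product using (∃; _×_; _,_)
open import Function using (_∘_)
open import Relation.Binary.PropositionalEquality
open ≡-Reasoning

module WalshAnalysis where
  open import Algebra.Bundles using (CommutativeRing)
  open import Data.Bool using (_≟_)
  open import Data.Bool.Properties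
    using (xor-assoc; xor-same; xor-identityʳ; ∧-zeroʳ; ∧-distribˡ-xor; xor-∧-commutativeRing)
  open import Algebra.Properties.CommutativeSemigroup
    (CommutativeRing.+-commutativeSemigroup xor-∧-commutativeRing) using () renaming (interchange to xor-interchange)
  open import Data.Empty using (⊥-elim)
  open import Data.Integer using (ℤ; +_; -_; -[1+_]; 0ℤ; 1ℤ; -1ℤ; _+_; _-_; _*_; ∣_∣)
  open import Data.Integer.Properties
    using ( +-identityˡ; +-identityʳ; +-comm; +-assoc; +-inverseʳ; *-identityˡ; *-identityʳ; *-zeroˡ; *-zeroʳ
          ; *-comm; *-distribˡ-+; *-distribʳ-+; -1*i≡-i; neg-involutive; pos-+; pos-*; abs-*)
  open import Data.Integer.Tactic.RingSolver using (solve-∀)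
  open import Data.List as List using (List; []; _∷_; map; filter; length)
  open import Data.List.Properties using (map-++; map-∘; map-cong)
  open import Data.Nat as ℕ using (ℕ; zero; suc; z≤n; s≤s)
  import Data.Nat.Properties as ℕₚ
  open import Data.Sum using (_⊎_; inj₁; inj₂)
  open import Data.Vec.Properties using (∷-injectiveʳ; cast-is-id)
  open import Relation.Binary.Definitions using (tri<; tri≈; tri>)

  ∑ : (n : ℕ) → (Vec Bool n → ℤ) → ℤ
  ∑ zero    g = g []
  ∑ (suc n) g = ∑ n (g ∘ (false ∷_)) + ∑ n (g ∘ (true ∷_))

  ∑-cong : ∀ n {g h : Vec Bool n → ℤ} → (∀ x → g x ≡ h x) → ∑ n g ≡ ∑ n h
  ∑-cong zero    g≗h = g≗h []
  ∑-cong (suc n) g≗h = cong₂ _+_ (∑-cong n (g≗h ∘ (false ∷_))) (∑-cong n (g≗h ∘ (true ∷_)))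

  ∑-zero : ∀ n (g : Vec Bool n → ℤ) → (∀ x → g x ≡ 0ℤ) → ∑ n g ≡ 0ℤ
  ∑-zero zero    g g≗0 = g≗0 []
  ∑-zero (suc n) g g≗0 = cong₂ _+_ (∑-zero n _ (g≗0 ∘ (false ∷_))) (∑-zero n _ (g≗0 ∘ (true ∷_)))

  2^suc≡2^+2^ : ∀ n → 2 ℕ.^ suc n ≡ 2 ℕ.^ n ℕ.+ 2 ℕ.^ n
  2^suc≡2^+2^ n = cong (2 ℕ.^ n ℕ.+_) (ℕₚ.+-identityʳ _)

  pos-2^-suc : ∀ n → + (2 ℕ.^ suc n) ≡ + (2 ℕ.^ n) + + (2 ℕ.^ n)
  pos-2^-suc n = trans (cong +_ (2^suc≡2^+2^ n)) (pos-+ (2 ℕ.^ n) _)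

  ∑-one : ∀ n → ∑ n (λ _ → 1ℤ) ≡ + (2 ℕ.^ n)
  ∑-one zero    = refl
  ∑-one (suc n) = trans (cong₂ _+_ (∑-one n) (∑-one n)) (sym (pos-2^-suc n))

  ∑-distrib-+ : ∀ n (g h : Vec Bool n → ℤ) → ∑ n (λ x → g x + h x) ≡ ∑ n g + ∑ n h
  ∑-distrib-+ zero    g h = refl
  ∑-distrib-+ (suc n) g h =
    trans (cong₂ _+_ (∑-distrib-+ n (g ∘ (false ∷_)) (h ∘ (false ∷_)))
                     (∑-distrib-+ n (g ∘ (true ∷_)) (h ∘ (true ∷_))))
          (+-interchange (∑ n (g ∘ (false ∷_))) _ _ _)
    where
    +-interchange : ∀ a b c d → (a + b) + (c + d) ≡ (a + c) + (b + d)
    +-interchange = solve-∀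

  *-distribˡ-∑ : ∀ n c (g : Vec Bool n → ℤ) → c * ∑ n g ≡ ∑ n λ x → c * g x
  *-distribˡ-∑ zero    c g = refl
  *-distribˡ-∑ (suc n) c g = trans (*-distribˡ-+ c (∑ n (g ∘ (false ∷_))) _)
    (cong₂ _+_ (*-distribˡ-∑ n c (g ∘ (false ∷_))) (*-distribˡ-∑ n c (g ∘ (true ∷_))))

  *-distribʳ-∑ : ∀ n c (g : Vec Bool n → ℤ) → ∑ n g * c ≡ ∑ n λ x → g x * c
  *-distribʳ-∑ zero    c g = refl
  *-distribʳ-∑ (suc n) c g = trans (*-distribʳ-+ c (∑ n (g ∘ (false ∷_))) _)
    (cong₂ _+_ (*-distribʳ-∑ n c (g ∘ (false ∷_))) (*-distribʳ-∑ n c (g ∘ (true ∷_))))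

  ∑-comm : ∀ n m (h : Vec Bool n → Vec Bool m → ℤ) → ∑ n (λ x → ∑ m (h x)) ≡ ∑ m λ y → ∑ n λ x → h x y
  ∑-comm zero    m h = refl
  ∑-comm (suc n) m h = trans (cong₂ _+_ (∑-comm n m _) (∑-comm n m _)) (sym (∑-distrib-+ m _ _))

  ∑-translate : ∀ n (g : Vec Bool n → ℤ) x → ∑ n g ≡ ∑ n λ a → g (x ⊕ a)
  ∑-translate zero    g []          = refl
  ∑-translate (suc n) g (false ∷ x) = cong₂ _+_ (∑-translate n _ x) (∑-translate n _ x)
  ∑-translate (suc n) g (true ∷ x)  =
    trans (+-comm (∑ n (g ∘ (false ∷_))) _) (cong₂ _+_ (∑-translate n _ x) (∑-translate n _ x))

  ∑-++ : ∀ n r (g : Vec Bool (n ℕ.+ r) → ℤ) → ∑ (n ℕ.+ r) g ≡ ∑ n λ t → ∑ r λ w → g (t ++ w)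
  ∑-++ zero    r g = refl
  ∑-++ (suc n) r g = cong₂ _+_ (∑-++ n r _) (∑-++ n r _)

  ∑-single : ∀ n (h : Vec Bool n → ℤ) c → (∀ a → a ≢ c → h a ≡ 0ℤ) → ∑ n h ≡ h c
  ∑-single zero    h []          h≗0 = refl
  ∑-single (suc n) h (false ∷ c) h≗0 =
    trans (cong₂ _+_ (∑-single n _ c (λ a a≢c → h≗0 (false ∷ a) (a≢c ∘ ∷-injectiveʳ)))
                     (∑-zero n _ (λ a → h≗0 (true ∷ a) (λ ()))))
          (+-identityʳ _)
  ∑-single (suc n) h (true ∷ c)  h≗0 =
    trans (cong₂ _+_ (∑-zero n _ (λ a → h≗0 (false ∷ a) (λ ())))
                     (∑-single n _ c (λ a a≢c → h≗0 (true ∷ a) (a≢c ∘ ∷-injectiveʳ))))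
          (+-identityˡ _)

  sumᴸ : List ℤ → ℤ
  sumᴸ = List.foldr _+_ 0ℤ

  sumᴸ-++ : ∀ xs ys → sumᴸ (xs List.++ ys) ≡ sumᴸ xs + sumᴸ ys
  sumᴸ-++ []       ys = sym (+-identityˡ _)
  sumᴸ-++ (x ∷ xs) ys = trans (cong (_+_ x) (sumᴸ-++ xs ys)) (sym (+-assoc x _ _))

  sumᴸ-allVecs : ∀ n (g : Vec Bool n → ℤ) → sumᴸ (map g (allVecs n)) ≡ ∑ n g
  sumᴸ-allVecs zero    g = +-identityʳ (g [])
  sumᴸ-allVecs (suc n) g = begin
    sumᴸ (map g (map (false ∷_) vs List.++ map (true ∷_) vs))
      ≡⟨ cong sumᴸ (map-++ g (map (false ∷_) vs) _) ⟩
    sumᴸ (map g (map (false ∷_) vs) List.++ map g (map (true ∷_) vs))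
      ≡⟨ sumᴸ-++ (map g (map (false ∷_) vs)) _ ⟩
    sumᴸ (map g (map (false ∷_) vs)) + sumᴸ (map g (map (true ∷_) vs))
      ≡⟨ cong₂ _+_ (cong sumᴸ (map-∘ vs)) (cong sumᴸ (map-∘ vs)) ⟨
    sumᴸ (map (g ∘ (false ∷_)) vs) + sumᴸ (map (g ∘ (true ∷_)) vs)
      ≡⟨ cong₂ _+_ (sumᴸ-allVecs n _) (sumᴸ-allVecs n _) ⟩
    ∑ (suc n) g ∎
    where
    vs : List (Vec Bool n)
    vs = allVecs n

  walsh≡∑ : ∀ {n} (g : Vec Bool n → Bool) u → walsh g u ≡ ∑ n λ x → sgn (g x xor dot u x)
  walsh≡∑ {n} g u = sumᴸ-allVecs n _

  walsh-cong : ∀ {n} {g h : Vec Bool n → Bool} → (∀ x → g x ≡ h x) → ∀ u → walsh g u ≡ walsh h u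
  walsh-cong {n} g≗h u =
    cong sumᴸ (map-cong (λ x → cong (λ b → sgn (b xor dot u x)) (g≗h x)) (allVecs n))

  walsh-cast : ∀ {m m′} (p : m ≡ m′) (f : Vec Bool m′ → Bool) u → walsh (f ∘ cast p) u ≡ walsh f (cast p u)
  walsh-cast refl f u rewrite cast-is-id refl u = walsh-cong (λ x → cong f (cast-is-id refl x)) u

  count : ∀ {A : Set} → (A → Bool) → Bool → List A → ℕ
  count h b xs = length (filter (λ x → h x ≟ b) xs)

  sumᴸ-sgn : ∀ {A : Set} (h : A → Bool) xs → sumᴸ (map (sgn ∘ h) xs) ≡ + count h false xs - + count h true xs
  sumᴸ-sgn h []       = refl
  sumᴸ-sgn h (x ∷ xs) with h x
  ... | false = trans (cong (_+_ 1ℤ) (sumᴸ-sgn h xs))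
                      (sym (+-assoc 1ℤ (+ count h false xs) (- + count h true xs)))
  ... | true  = trans (cong (_+_ -1ℤ) (sumᴸ-sgn h xs))
                      (-1+[p-q]≡p-[1+q] (+ count h false xs) (+ count h true xs))
    where
    -1+[p-q]≡p-[1+q] : ∀ p q → -1ℤ + (p - q) ≡ p - (1ℤ + q)
    -1+[p-q]≡p-[1+q] = solve-∀

  ⊕-identityʳ : ∀ {n} (x : Vec Bool n) → x ⊕ zeroVec n ≡ x
  ⊕-identityʳ []      = refl
  ⊕-identityʳ (b ∷ x) = cong₂ _∷_ (xor-identityʳ b) (⊕-identityʳ x)

  ⊕≡zeroVec⇒≡ : ∀ {n} (x y : Vec Bool n) → x ⊕ y ≡ zeroVec n → y ≡ x
  ⊕≡zeroVec⇒≡ []          []          _     = refl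
  ⊕≡zeroVec⇒≡ (false ∷ x) (false ∷ y) x⊕y≡0 = cong (false ∷_) (⊕≡zeroVec⇒≡ x y (∷-injectiveʳ x⊕y≡0))
  ⊕≡zeroVec⇒≡ (true ∷ x)  (true ∷ y)  x⊕y≡0 = cong (true ∷_) (⊕≡zeroVec⇒≡ x y (∷-injectiveʳ x⊕y≡0))
  ⊕≡zeroVec⇒≡ (false ∷ x) (true ∷ y)  ()
  ⊕≡zeroVec⇒≡ (true ∷ x)  (false ∷ y) ()

  dot-zeroVecʳ : ∀ {n} (u : Vec Bool n) → dot u (zeroVec n) ≡ false
  dot-zeroVecʳ []      = refl
  dot-zeroVecʳ (b ∷ u) = cong₂ _xor_ (∧-zeroʳ b) (dot-zeroVecʳ u)

  dot-⊕ʳ : ∀ {n} (u x y : Vec Bool n) → dot u (x ⊕ y) ≡ dot u x xor dot u y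
  dot-⊕ʳ []       []       []       = refl
  dot-⊕ʳ (u₀ ∷ u) (x₀ ∷ x) (y₀ ∷ y) =
    trans (cong₂ _xor_ (∧-distribˡ-xor u₀ x₀ y₀) (dot-⊕ʳ u x y)) (xor-interchange (u₀ ∧ x₀) _ _ _)

  dot-++ : ∀ {n r} (a t : Vec Bool n) (b w : Vec Bool r) → dot (a ++ b) (t ++ w) ≡ dot a t xor dot b w
  dot-++ []       []       b w = refl
  dot-++ (a₀ ∷ a) (t₀ ∷ t) b w =
    trans (cong (a₀ ∧ t₀ xor_) (dot-++ a t b w)) (sym (xor-assoc (a₀ ∧ t₀) (dot a t) (dot b w)))

  sgn-xor : ∀ a b → sgn (a xor b) ≡ sgn a * sgn b
  sgn-xor false false = refl
  sgn-xor false true  = refl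
  sgn-xor true  false = refl
  sgn-xor true  true  = refl

  sgn-square : ∀ a → sgn a * sgn a ≡ 1ℤ
  sgn-square false = refl
  sgn-square true  = refl

  χ : ∀ {n} → Vec Bool n → Vec Bool n → ℤ
  χ u x = sgn (dot u x)

  χ-⊕ʳ : ∀ {n} (u x y : Vec Bool n) → χ u (x ⊕ y) ≡ χ u x * χ u y
  χ-⊕ʳ u x y = trans (cong sgn (dot-⊕ʳ u x y)) (sgn-xor (dot u x) (dot u y))

  χ-zeroVecʳ : ∀ {n} (u : Vec Bool n) → χ u (zeroVec n) ≡ 1ℤ
  χ-zeroVecʳ u = cong sgn (dot-zeroVecʳ u)

  ∑-χ-≢zeroVec : ∀ n (u : Vec Bool n) → u ≢ zeroVec n → ∑ n (λ b → χ b u) ≡ 0ℤ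
  ∑-χ-≢zeroVec zero    []          u≢0 = ⊥-elim (u≢0 refl)
  ∑-χ-≢zeroVec (suc n) (false ∷ u) u≢0 =
    cong₂ _+_ (∑-χ-≢zeroVec n u (u≢0 ∘ cong (false ∷_))) (∑-χ-≢zeroVec n u (u≢0 ∘ cong (false ∷_)))
  ∑-χ-≢zeroVec (suc n) (true ∷ u)  u≢0 = begin
    S + ∑ n (λ b → sgn (true xor dot b u))  ≡⟨ cong (_+_ S) (∑-cong n λ b → sgn-xor true (dot b u)) ⟩
    S + ∑ n (λ b → -1ℤ * χ b u)             ≡⟨ cong (_+_ S) (*-distribˡ-∑ n -1ℤ _) ⟨
    S + -1ℤ * S                             ≡⟨ s-s≡0 S ⟩
    0ℤ                                      ∎
    where
    S : ℤ
    S = ∑ n (λ b → χ b u)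
    s-s≡0 : ∀ s → s + -1ℤ * s ≡ 0ℤ
    s-s≡0 = solve-∀

  ∑-χ-orthogonal : ∀ n (v w : Vec Bool n) → w ≢ v → ∑ n (λ b → χ b v * χ b w) ≡ 0ℤ
  ∑-χ-orthogonal n v w w≢v =
    trans (∑-cong n λ b → sym (χ-⊕ʳ b v w)) (∑-χ-≢zeroVec n (v ⊕ w) (w≢v ∘ ⊕≡zeroVec⇒≡ v w))

  ∑-χ-square : ∀ n (v : Vec Bool n) → ∑ n (λ b → χ b v * χ b v) ≡ + (2 ℕ.^ n)
  ∑-χ-square n v = trans (∑-cong n λ b → sgn-square (dot b v)) (∑-one n)

  fourier-inversion : ∀ r (F : Vec Bool r → ℤ) v →
    ∑ r (λ b → χ b v * ∑ r λ w → F w * χ b w) ≡ + (2 ℕ.^ r) * F v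
  fourier-inversion r F v = begin
    ∑ r (λ b → χ b v * ∑ r λ w → F w * χ b w)
      ≡⟨ ∑-cong r (λ b → *-distribˡ-∑ r (χ b v) _) ⟩
    ∑ r (λ b → ∑ r λ w → χ b v * (F w * χ b w))
      ≡⟨ ∑-comm r r _ ⟩
    ∑ r (λ w → ∑ r λ b → χ b v * (F w * χ b w))
      ≡⟨ ∑-cong r (λ w → ∑-cong r λ b → x[yz]≡y[xz] (χ b v) (F w) (χ b w)) ⟩
    ∑ r (λ w → ∑ r λ b → F w * (χ b v * χ b w))
      ≡⟨ ∑-cong r (λ w → *-distribˡ-∑ r (F w) _) ⟨
    ∑ r (λ w → F w * ∑ r λ b → χ b v * χ b w)
      ≡⟨ ∑-single r _ v vanishes-off-v ⟩
    F v * ∑ r (λ b → χ b v * χ b v)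
      ≡⟨ cong (F v *_) (∑-χ-square r v) ⟩
    F v * + (2 ℕ.^ r)
      ≡⟨ *-comm (F v) _ ⟩
    + (2 ℕ.^ r) * F v
      ∎
    where
    x[yz]≡y[xz] : ∀ x y z → x * (y * z) ≡ y * (x * z)
    x[yz]≡y[xz] = solve-∀

    vanishes-off-v : ∀ w → w ≢ v → F w * ∑ r (λ b → χ b v * χ b w) ≡ 0ℤ
    vanishes-off-v w w≢v = trans (cong (F w *_) (∑-χ-orthogonal r v w w≢v)) (*-zeroʳ (F w))

  walsh-++ : ∀ n r (G : Vec Bool (n ℕ.+ r) → Bool) a b →
    walsh G (a ++ b) ≡ ∑ r λ w → walsh (λ t → G (t ++ w)) a * χ b w
  walsh-++ n r G a b = begin
    walsh G (a ++ b)
      ≡⟨ walsh≡∑ G (a ++ b) ⟩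
    ∑ (n ℕ.+ r) (λ x → sgn (G x xor dot (a ++ b) x))
      ≡⟨ ∑-++ n r _ ⟩
    ∑ n (λ t → ∑ r λ w → sgn (G (t ++ w) xor dot (a ++ b) (t ++ w)))
      ≡⟨ ∑-cong n (λ t → ∑-cong r (split t)) ⟩
    ∑ n (λ t → ∑ r λ w → sgn (G (t ++ w) xor dot a t) * χ b w)
      ≡⟨ ∑-comm n r _ ⟩
    ∑ r (λ w → ∑ n λ t → sgn (G (t ++ w) xor dot a t) * χ b w)
      ≡⟨ ∑-cong r (λ w → *-distribʳ-∑ n (χ b w) _) ⟨
    ∑ r (λ w → ∑ n (λ t → sgn (G (t ++ w) xor dot a t)) * χ b w)
      ≡⟨ ∑-cong r (λ w → cong (_* χ b w) (walsh≡∑ (λ t → G (t ++ w)) a)) ⟨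
    ∑ r (λ w → walsh (λ t → G (t ++ w)) a * χ b w)
      ∎
    where
    split : ∀ t w → sgn (G (t ++ w) xor dot (a ++ b) (t ++ w)) ≡ sgn (G (t ++ w) xor dot a t) * χ b w
    split t w = begin
      sgn (G (t ++ w) xor dot (a ++ b) (t ++ w)) ≡⟨ cong (λ d → sgn (G (t ++ w) xor d)) (dot-++ a t b w) ⟩
      sgn (G (t ++ w) xor (dot a t xor dot b w)) ≡⟨ cong sgn (xor-assoc (G (t ++ w)) _ _) ⟨
      sgn ((G (t ++ w) xor dot a t) xor dot b w) ≡⟨ sgn-xor (G (t ++ w) xor dot a t) (dot b w) ⟩
      sgn (G (t ++ w) xor dot a t) * χ b w       ∎

  walsh-restriction : ∀ n r (G : Vec Bool (n ℕ.+ r) → Bool) v a →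
    + (2 ℕ.^ r) * walsh (λ t → G (t ++ v)) a ≡ ∑ r λ b → χ b v * walsh G (a ++ b)
  walsh-restriction n r G v a =
    sym (trans (∑-cong r λ b → cong (χ b v *_) (walsh-++ n r G a b))
               (fourier-inversion r (λ w → walsh (λ t → G (t ++ w)) a) v))

  autocorrelation : ∀ {n} → (Vec Bool n → Bool) → Vec Bool n → ℤ
  autocorrelation {n} g a = ∑ n λ x → sgn (g (x ⊕ a) xor g x)

  autocorrelation-zeroVec : ∀ {n} (g : Vec Bool n → Bool) → autocorrelation g (zeroVec n) ≡ + (2 ℕ.^ n)
  autocorrelation-zeroVec {n} g =
    trans (∑-cong n λ x → cong sgn (trans (cong (λ y → g y xor g x) (⊕-identityʳ x)) (xor-same (g x))))
          (∑-one n)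

  autocorrelation-bent : ∀ {n} (g : Vec Bool n → Bool) → IsBent g →
    ∀ a → a ≢ zeroVec n → autocorrelation g a ≡ 0ℤ
  autocorrelation-bent {n} g bent a a≢0 = begin
    autocorrelation g a
      ≡⟨ sumᴸ-allVecs n _ ⟨
    sumᴸ (map (sgn ∘ Dₐg) (allVecs n))
      ≡⟨ sumᴸ-sgn Dₐg (allVecs n) ⟩
    + derivCount g a false - + derivCount g a true
      ≡⟨ cong₂ (λ p q → + p - + q) (bent a a≢0 false) (bent a a≢0 true) ⟩
    + (2 ℕ.^ (n ℕ.∸ 1)) - + (2 ℕ.^ (n ℕ.∸ 1))
      ≡⟨ +-inverseʳ (+ (2 ℕ.^ (n ℕ.∸ 1))) ⟩
    0ℤ
      ∎
    where
    Dₐg : Vec Bool n → Bool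
    Dₐg x = g (x ⊕ a) xor g x

  walsh²-bent : ∀ {n} (g : Vec Bool n → Bool) → IsBent g → ∀ u → walsh g u * walsh g u ≡ + (2 ℕ.^ n)
  walsh²-bent {n} g bent u = begin
    walsh g u * walsh g u
      ≡⟨ cong₂ _*_ (walsh≡∑ g u) (walsh≡∑ g u) ⟩
    ∑ n P * ∑ n P
      ≡⟨ *-distribʳ-∑ n (∑ n P) P ⟩
    ∑ n (λ x → P x * ∑ n P)
      ≡⟨ ∑-cong n (λ x → *-distribˡ-∑ n (P x) P) ⟩
    ∑ n (λ x → ∑ n λ y → P x * P y)
      ≡⟨ ∑-cong n (λ x → ∑-translate n _ x) ⟩
    ∑ n (λ x → ∑ n λ a → P x * P (x ⊕ a))
      ≡⟨ ∑-cong n (λ x → ∑-cong n (P-product x)) ⟩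
    ∑ n (λ x → ∑ n λ a → sgn (g (x ⊕ a) xor g x) * χ u a)
      ≡⟨ ∑-comm n n _ ⟩
    ∑ n (λ a → ∑ n λ x → sgn (g (x ⊕ a) xor g x) * χ u a)
      ≡⟨ ∑-cong n (λ a → *-distribʳ-∑ n (χ u a) _) ⟨
    ∑ n (λ a → autocorrelation g a * χ u a)
      ≡⟨ ∑-single n _ (zeroVec n) vanishes-off-zeroVec ⟩
    autocorrelation g (zeroVec n) * χ u (zeroVec n)
      ≡⟨ cong₂ _*_ (autocorrelation-zeroVec g) (χ-zeroVecʳ u) ⟩
    + (2 ℕ.^ n) * 1ℤ
      ≡⟨ *-identityʳ _ ⟩
    + (2 ℕ.^ n)
      ∎
    where
    P : Vec Bool n → ℤ
    P x = sgn (g x xor dot u x)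

    regroup : ∀ s c s′ c′ → (s * c) * (s′ * (c * c′)) ≡ (s′ * s) * c′ * (c * c)
    regroup = solve-∀

    P-product : ∀ x a → P x * P (x ⊕ a) ≡ sgn (g (x ⊕ a) xor g x) * χ u a
    P-product x a = begin
      P x * P (x ⊕ a)
        ≡⟨ cong₂ _*_ (sgn-xor (g x) (dot u x)) (sgn-xor (g (x ⊕ a)) (dot u (x ⊕ a))) ⟩
      (sgn (g x) * χ u x) * (sgn (g (x ⊕ a)) * χ u (x ⊕ a))
        ≡⟨ cong (λ c → (sgn (g x) * χ u x) * (sgn (g (x ⊕ a)) * c)) (χ-⊕ʳ u x a) ⟩
      (sgn (g x) * χ u x) * (sgn (g (x ⊕ a)) * (χ u x * χ u a))
        ≡⟨ regroup (sgn (g x)) (χ u x) (sgn (g (x ⊕ a))) (χ u a) ⟩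
      (sgn (g (x ⊕ a)) * sgn (g x)) * χ u a * (χ u x * χ u x)
        ≡⟨ cong₂ (λ s c → s * χ u a * c) (sym (sgn-xor (g (x ⊕ a)) (g x))) (sgn-square (dot u x)) ⟩
      sgn (g (x ⊕ a) xor g x) * χ u a * 1ℤ
        ≡⟨ *-identityʳ _ ⟩
      sgn (g (x ⊕ a) xor g x) * χ u a
        ∎

    vanishes-off-zeroVec : ∀ a → a ≢ zeroVec n → autocorrelation g a * χ u a ≡ 0ℤ
    vanishes-off-zeroVec a a≢0 = trans (cong (_* χ u a) (autocorrelation-bent g bent a a≢0)) (*-zeroˡ (χ u a))

  infix 4 _≡±_
  _≡±_ : ℤ → ℤ → Set
  z ≡± c = z ≡ c ⊎ z ≡ - c

  neg-≡± : ∀ {z c} → z ≡± c → - z ≡± c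
  neg-≡± (inj₁ refl) = inj₂ refl
  neg-≡± (inj₂ refl) = inj₁ (neg-involutive _)

  sgn-*-≡± : ∀ s {z c} → z ≡± c → sgn s * z ≡± c
  sgn-*-≡± false {z} z≡±c = subst (_≡± _) (sym (*-identityˡ z)) z≡±c
  sgn-*-≡± true  {z} z≡±c = subst (_≡± _) (sym (-1*i≡-i z)) (neg-≡± z≡±c)

  m*m≡n*n⇒m≡n : ∀ m n → m ℕ.* m ≡ n ℕ.* n → m ≡ n
  m*m≡n*n⇒m≡n m n m*m≡n*n with ℕₚ.<-cmp m n
  ... | tri< m<n _ _ = ⊥-elim (ℕₚ.<-irrefl m*m≡n*n (ℕₚ.*-mono-< m<n m<n))
  ... | tri≈ _ m≡n _ = m≡n
  ... | tri> _ _ m>n = ⊥-elim (ℕₚ.<-irrefl (sym m*m≡n*n) (ℕₚ.*-mono-< m>n m>n))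

  ≡±-of-square : ∀ N z → z * z ≡ + (N ℕ.* N) → z ≡± + N
  ≡±-of-square N z z*z≡N*N with m*m≡n*n⇒m≡n ∣ z ∣ N (trans (sym (abs-* z z)) (cong ∣_∣ z*z≡N*N))
  ≡±-of-square N (+ n)    _ | ∣z∣≡N = inj₁ (cong +_ ∣z∣≡N)
  ≡±-of-square N -[1+ n ] _ | refl  = inj₂ refl

  walsh-bent-≡± : ∀ k (f : Vec Bool (2 ℕ.* k) → Bool) → IsBent f → ∀ u → walsh f u ≡± + (2 ℕ.^ k)
  walsh-bent-≡± k f bent u =
    ≡±-of-square (2 ℕ.^ k) (walsh f u) (trans (walsh²-bent f bent u) (cong +_ 2^[2k]≡2^k*2^k))
    where
    2^[2k]≡2^k*2^k : 2 ℕ.^ (2 ℕ.* k) ≡ 2 ℕ.^ k ℕ.* 2 ℕ.^ k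
    2^[2k]≡2^k*2^k = trans (cong (λ j → 2 ℕ.^ (k ℕ.+ j)) (ℕₚ.+-identityʳ k)) (ℕₚ.^-distribˡ-+-* 2 k k)

  ∑-≡± : ∀ r (h : Vec Bool r → ℤ) {c} → (∀ b → h b ≡± c) →
    ∃ λ i → i ℕ.≤ 2 ℕ.^ r × ∑ r h ≡ + (2 ℕ.^ r) * c - + i * (+ 2 * c)
  ∑-≡± zero h {c} h≡±c with h≡±c []
  ... | inj₁ h≡c  = 0 , z≤n , trans h≡c (c≡1c-0[2c] c)
    where
    c≡1c-0[2c] : ∀ c → c ≡ 1ℤ * c - 0ℤ * (+ 2 * c)
    c≡1c-0[2c] = solve-∀
  ... | inj₂ h≡-c = 1 , s≤s z≤n , trans h≡-c (-c≡1c-1[2c] c)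
    where
    -c≡1c-1[2c] : ∀ c → - c ≡ 1ℤ * c - 1ℤ * (+ 2 * c)
    -c≡1c-1[2c] = solve-∀
  ∑-≡± (suc r) h {c} h≡±c
    with ∑-≡± r (h ∘ (false ∷_)) (h≡±c ∘ (false ∷_)) | ∑-≡± r (h ∘ (true ∷_)) (h≡±c ∘ (true ∷_))
  ... | i₀ , i₀≤2^r , ∑₀ | i₁ , i₁≤2^r , ∑₁ =
    i₀ ℕ.+ i₁ , ℕₚ.≤-trans (ℕₚ.+-mono-≤ i₀≤2^r i₁≤2^r) (ℕₚ.≤-reflexive (sym (2^suc≡2^+2^ r))) , (begin
      ∑ r (h ∘ (false ∷_)) + ∑ r (h ∘ (true ∷_))
        ≡⟨ cong₂ _+_ ∑₀ ∑₁ ⟩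
      (A * c - + i₀ * (+ 2 * c)) + (A * c - + i₁ * (+ 2 * c))
        ≡⟨ regroup A c (+ i₀) (+ i₁) ⟩
      (A + A) * c - (+ i₀ + + i₁) * (+ 2 * c)
        ≡⟨ cong₂ (λ p q → p * c - q * (+ 2 * c)) (pos-2^-suc r) (pos-+ i₀ i₁) ⟨
      + (2 ℕ.^ suc r) * c - + (i₀ ℕ.+ i₁) * (+ 2 * c)
        ∎)
    where
    A : ℤ
    A = + (2 ℕ.^ r)
    regroup : ∀ A c x y → (A * c - x * (+ 2 * c)) + (A * c - y * (+ 2 * c)) ≡ (A + A) * c - (x + y) * (+ 2 * c)
    regroup = solve-∀

  pos-2^*2^ : ∀ k r → + (2 ℕ.^ r) * + (2 ℕ.^ k) ≡ + (2 ℕ.^ (k ℕ.+ r))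
  pos-2^*2^ k r = begin
    + (2 ℕ.^ r) * + (2 ℕ.^ k)   ≡⟨ *-comm (+ (2 ℕ.^ r)) _ ⟩
    + (2 ℕ.^ k) * + (2 ℕ.^ r)   ≡⟨ pos-* (2 ℕ.^ k) _ ⟨
    + (2 ℕ.^ k ℕ.* 2 ℕ.^ r)     ≡⟨ cong +_ (ℕₚ.^-distribˡ-+-* 2 k r) ⟨
    + (2 ℕ.^ (k ℕ.+ r))         ∎

  pos-2*2^ : ∀ k → + 2 * + (2 ℕ.^ k) ≡ + (2 ℕ.^ (k ℕ.+ 1))
  pos-2*2^ k = trans (sym (pos-* 2 (2 ℕ.^ k))) (cong (λ j → + (2 ℕ.^ j)) (ℕₚ.+-comm 1 k))

open WalshAnalysis
open import Data.Nat using (ℕ; _+_; _*_; _^_; _∸_; _≤_)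
open import Data.Integer using (+_; _-_) renaming (_*_ to _*ℤ_)
open import Data.Nat.Properties using (m∸n+n≡m)

mainTheorem7 : (k r : ℕ) → (hr : r ≤ 2 * k) → (f : Vec Bool (2 * k) → Bool) → IsBent f →
    (λ' : Vec Bool r) → (a : Vec Bool (2 * k ∸ r)) →
    ∃ λ (i : ℕ) → i ≤ 2 ^ r ×
      (+ (2 ^ r)) *ℤ walsh (λ t → f (cast (m∸n+n≡m hr) (t ++ λ'))) a
        ≡ + (2 ^ (k + r)) - (+ i) *ℤ (+ (2 ^ (k + 1)))
mainTheorem7 k r hr f bent λ' a =
  let i , i≤2^r , ∑≡ = ∑-≡± r (λ b → χ b λ' *ℤ walsh G (a ++ b))
                             (λ b → sgn-*-≡± (dot b λ') (walsh-G-≡± (a ++ b)))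
  in i , i≤2^r , (begin
    + (2 ^ r) *ℤ walsh (λ t → G (t ++ λ')) a
      ≡⟨ walsh-restriction (2 * k ∸ r) r G λ' a ⟩
    ∑ r (λ b → χ b λ' *ℤ walsh G (a ++ b))
      ≡⟨ ∑≡ ⟩
    + (2 ^ r) *ℤ + (2 ^ k) - + i *ℤ (+ 2 *ℤ + (2 ^ k))
      ≡⟨ cong₂ (λ p q → p - + i *ℤ q) (pos-2^*2^ k r) (pos-2*2^ k) ⟩
    + (2 ^ (k + r)) - + i *ℤ + (2 ^ (k + 1))
      ∎)
  where
  G : Vec Bool (2 * k ∸ r + r) → Bool
  G = f ∘ cast (m∸n+n≡m hr)

  walsh-G-≡± : ∀ u → walsh G u ≡± + (2 ^ k)
  walsh-G-≡± u = subst (_≡± _) (sym (walsh-cast (m∸n+n≡m hr) f u))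
                             (walsh-bent-≡± k f bent (cast (m∸n+n≡m hr) u))
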